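{- Let $n\ge2$, $d\ge1$, $r\ge3$ be integers with $n\ge d$ and $dr\equiv0\pmod n$. If $dr=n$, then $\mathrm{diam}(Q_n(d,r))=n+r$ when $r=3$ and $\mathrm{diam}(Q_n(d,r))=n+\lfloor 3r/2\rfloor-2$ when $r\ge4$. If $dr\ge 2n$, then $\mathrm{diam}(Q_n(d,r))=n+\max\{\lfloor r/2\rfloor,\,2\lceil n/d\rceil-2\}$.
   Context: For $1\le i\le n$ let $\mathbf e_i\in\mathbb Z_2^n$ be the $i$-th standard basis row vector, subscripts read modulo $n$; $M$ is the $n\times n$ permutation matrix over $\mathbb F_2$ with $\mathbf e_iM=\mathbf e_{i+1}$; $G=\mathbb Z_2^n\rtimes\mathbb Z_r$ is the group on $\mathbb Z_2^n\times\mathbb Z_r$ with $(\mathbf a,x)(\mathbf b,y)=(\mathbf a+\mathbf bM^{dx},x+y)$. The recursive cube of rings $Q_n(d,r)$ is the Cayley graph $\mathrm{Cay}(G,S)$ with $S=\{(\mathbf 0_n,1),(\mathbf 0_n,r-1),(\mathbf e_1,0),\dots,(\mathbf e_d,0)\}$: the neighbours of $(\mathbf a,x)$ are $(\mathbf a+\mathbf e_{i+dx},x)$, $1\le i\le d$, and $(\mathbf a,x\pm1)$. $\mathrm{diam}$ denotes the graph diameter. -}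

module Defs where

open import Data.Nat using (ℕ; zero; suc; _+_; _*_; _∸_; _≤_; NonZero)
open import Data.Nat.DivMod using (_%_; _/_; m%n<n)
open import Data.Fin using (Fin; toℕ; fromℕ<)
open import Data.Bool using (Bool; not)
open import Data.Vec using (Vec; updateAt)
open import Data.Product using (_×_; _,_; ∃; ∃-syntax)

-- Vertices of Q_n(d,r): pairs (a , x) with a ∈ Z_2^n (a Bool vector) and x ∈ Z_r.
-- Coordinates are 0-based: Fin n position p corresponds to e_{p+1} in the paper.
Vertex : ℕ → ℕ → Set
Vertex n r = Vec Bool n × Fin r

flipAt : ∀ {n} → Vec Bool n → Fin n → Vec Bool n
flipAt a p = updateAt a p not

-- (0-based) index of e_{i+dx} for the paper's i = j+1, j ∈ {0,…,d-1}:
-- (j + d·x) mod n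
cubePos : (n d : ℕ) .{{_ : NonZero n}} {r : ℕ} → Fin d → Fin r → Fin n
cubePos n d j x = fromℕ< (m%n<n (toℕ j + d * toℕ x) n)

succR : (r : ℕ) .{{_ : NonZero r}} → Fin r → Fin r
succR r x = fromℕ< (m%n<n (suc (toℕ x)) r)

predR : (r : ℕ) .{{_ : NonZero r}} → Fin r → Fin r
predR r x = fromℕ< (m%n<n (toℕ x + (r ∸ 1)) r)

-- Adjacency in the Cayley graph Cay(G,S): right multiplication by the generators in S.
data Adj (n d r : ℕ) .{{_ : NonZero n}} .{{_ : NonZero r}} : Vertex n r → Vertex n r → Set where
  cube : ∀ a x (j : Fin d) → Adj n d r (a , x) (flipAt a (cubePos n d j x) , x)
  fwd  : ∀ a x → Adj n d r (a , x) (a , succR r x)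
  bwd  : ∀ a x → Adj n d r (a , x) (a , predR r x)

data Walk (n d r : ℕ) .{{_ : NonZero n}} .{{_ : NonZero r}} : Vertex n r → Vertex n r → ℕ → Set where
  nil  : ∀ {u} → Walk n d r u u 0
  cons : ∀ {u v w k} → Adj n d r u v → Walk n d r v w k → Walk n d r u w (suc k)

IsDiameter : (n d r : ℕ) .{{_ : NonZero n}} .{{_ : NonZero r}} → ℕ → Set
IsDiameter n d r D =
  (∀ (u v : Vertex n r) → ∃[ k ] (k ≤ D × Walk n d r u v k)) ×
  (∃[ u ] ∃[ v ] (∀ k → Walk n d r u v k → D ≤ k))

ceilDiv : (m k : ℕ) .{{_ : NonZero k}} → ℕ
ceilDiv m k = (m + (k ∸ 1)) / k

module Submission where

-- At ring position x the cube edges flip the coordinates j + d x (mod n), j < d; as n ∣ d r these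
-- depend only on x mod r.
--
-- Upper bound: walk around the ring and, at each visited position, correct the reachable
-- coordinates that differ from the target.  This costs (ring steps) + (corrections) ≤ steps + n,
-- and if n ≤ d (m+1) the m+1 visited positions reach every coordinate (repairWalk, route).
--
-- Lower bound: along any walk from (0⃗ , 0) an invariant (Trace) records the window of unwrapped
-- ring positions visited, where each 1 was flipped, and a length budget.  At (1⃗ , y) the window
-- must cover Z_n, so n ≤ d (W+1), and n + 2W ≤ k + e with net displacement e ≡ ±y (mod r) (Final).

open import Defs
open import Data.Nat
open import Data.Nat.Properties
open import Data.Nat.DivMod
open import Data.Nat.Divisibility using (_∣_; ∣n⇒∣m*n)
open import Data.Nat.Tactic.RingSolver using (solve-∀)
open import Data.Bool using (Bool; true; false; not)
open import Data.Bool.Properties using () renaming (_≟_ to _≟ᵇ_)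
open import Data.Fin using (Fin; zero; suc; toℕ; fromℕ<)
open import Data.Fin.Properties using (toℕ-fromℕ<; toℕ-injective; toℕ<n) renaming (_≟_ to _≟ᶠ_)
open import Data.Vec using (Vec; []; _∷_; lookup; replicate)
open import Data.Vec.Properties using (lookup-replicate; lookup∘updateAt; lookup∘updateAt′; tabulate∘lookup; tabulate-cong)
open import Data.List using (List; []; _∷_; allFin)
open import Data.List.Membership.Propositional using (_∈_)
open import Data.List.Membership.Propositional.Properties using (∈-allFin)
open import Data.List.Relation.Unary.Any using (here; there)
open import Data.Product using (_×_; _,_; ∃; ∃-syntax; proj₁; proj₂)
open import Data.Sum using (_⊎_; inj₁; inj₂)
open import Data.Empty using (⊥-elim)
open import Relation.Nullary using (¬_; yes; no)
open import Relation.Binary.PropositionalEquality using (_≡_; refl; sym; trans; cong; cong₂; subst; subst₂; module ≡-Reasoning)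

%-cong-+ʳ : ∀ {a b} c m .{{_ : NonZero m}} → a % m ≡ b % m → (a + c) % m ≡ (b + c) % m
%-cong-+ʳ {a} {b} c m a≡b = begin
  (a + c) % m           ≡⟨ %-distribˡ-+ a c m ⟩
  (a % m + c % m) % m   ≡⟨ cong (λ z → (z + c % m) % m) a≡b ⟩
  (b % m + c % m) % m   ≡⟨ %-distribˡ-+ b c m ⟨
  (b + c) % m           ∎
  where open ≡-Reasoning

%-cancel-+ʳ : ∀ {a b} c m .{{_ : NonZero m}} → (a + c) % m ≡ (b + c) % m → a % m ≡ b % m
%-cancel-+ʳ {a} {b} c m eq = begin
  a % m                    ≡⟨ [m+kn]%n≡m%n a c m ⟨
  (a + c * m) % m          ≡⟨ cong (_% m) (split a) ⟩
  (a + c + c * pred m) % m ≡⟨ %-cong-+ʳ (c * pred m) m eq ⟩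
  (b + c + c * pred m) % m ≡⟨ cong (_% m) (split b) ⟨
  (b + c * m) % m          ≡⟨ [m+kn]%n≡m%n b c m ⟩
  b % m                    ∎
  where
  open ≡-Reasoning
  split : ∀ x → x + c * m ≡ x + c + c * pred m
  split x = begin
    x + c * m              ≡⟨ cong (λ z → x + c * z) (suc-pred m) ⟨
    x + c * suc (pred m)   ≡⟨ peel x c (pred m) ⟩
    x + c + c * pred m     ∎
    where
    peel : ∀ x c p → x + c * suc p ≡ x + c + c * p
    peel = solve-∀

%-reduceˡ : ∀ a c m .{{_ : NonZero m}} → (a % m + c) % m ≡ (a + c) % m
%-reduceˡ a c m = %-cong-+ʳ c m (m%n%n≡m%n a m)

%-reduceʳ : ∀ a c m .{{_ : NonZero m}} → (a + c % m) % m ≡ (a + c) % m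
%-reduceʳ a c m = begin
  (a + c % m) % m ≡⟨ cong (_% m) (+-comm a (c % m)) ⟩
  (c % m + a) % m ≡⟨ %-reduceˡ c a m ⟩
  (c + a) % m     ≡⟨ cong (_% m) (+-comm c a) ⟩
  (a + c) % m     ∎
  where open ≡-Reasoning

%-add-complement : ∀ a z m .{{_ : NonZero m}} → ((a + (m ∸ z % m)) % m + z) % m ≡ a % m
%-add-complement a z m = begin
  ((a + (m ∸ z % m)) % m + z) % m  ≡⟨ %-reduceˡ (a + (m ∸ z % m)) z m ⟩
  (a + (m ∸ z % m) + z) % m        ≡⟨ %-reduceʳ (a + (m ∸ z % m)) z m ⟨
  (a + (m ∸ z % m) + z % m) % m    ≡⟨ cong (_% m) (+-assoc a (m ∸ z % m) (z % m)) ⟩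
  (a + (m ∸ z % m + z % m)) % m    ≡⟨ cong (λ w → (a + w) % m) (m∸n+n≡m (m%n≤n z m)) ⟩
  (a + m) % m                      ≡⟨ [m+n]%n≡m%n a m ⟩
  a % m                            ∎
  where open ≡-Reasoning

div-mod-form : ∀ {e c q} m .{{_ : NonZero m}} → e % m ≡ c → e / m ≡ q → e ≡ c + q * m
div-mod-form {e} m rem quot = trans (m≡m%n+[m/n]*n e m) (cong₂ (λ u v → u + v * m) rem quot)

multiple-0-or-≥ : ∀ e m .{{_ : NonZero m}} → e % m ≡ 0 → e ≡ 0 ⊎ m ≤ e
multiple-0-or-≥ e m e%m≡0 with e / m in q
... | zero  = inj₁ (div-mod-form m e%m≡0 q)
... | suc k = inj₂ (subst (m ≤_) (sym (div-mod-form m e%m≡0 q)) (m≤m+n m (k * m)))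

%-gap : ∀ {a b} m .{{_ : NonZero m}} → a < b → a % m ≡ b % m → a + m ≤ b
%-gap {a} {b} m a<b a≡b with multiple-0-or-≥ (b ∸ a) m gap%m≡0
  where
  gap%m≡0 : (b ∸ a) % m ≡ 0
  gap%m≡0 = trans (%-cancel-+ʳ a m (trans (cong (_% m) (m∸n+n≡m (<⇒≤ a<b))) (sym a≡b)))
                  (m<n⇒m%n≡m (>-nonZero⁻¹ m))
... | inj₁ gap≡0 = ⊥-elim (<⇒≢ (m<n⇒0<n∸m a<b) (sym gap≡0))
... | inj₂ m≤gap = subst (a + m ≤_) (m+[n∸m]≡n (<⇒≤ a<b)) (+-monoʳ-≤ a m≤gap)

d*-mod : ∀ {n d r} .{{_ : NonZero n}} .{{_ : NonZero r}} → n ∣ d * r →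
         ∀ {a b} → a % r ≡ b % r → (d * a) % n ≡ (d * b) % n
d*-mod {n} {d} {r} n∣dr {a} {b} a≡b = begin
  (d * a) % n        ≡⟨ reduce a ⟩
  (d * (a % r)) % n  ≡⟨ cong (λ z → (d * z) % n) a≡b ⟩
  (d * (b % r)) % n  ≡⟨ reduce b ⟨
  (d * b) % n        ∎
  where
  open ≡-Reasoning
  expand : ∀ d r x y → d * (x + y * r) ≡ d * x + y * (d * r)
  expand = solve-∀
  reduce : ∀ x → (d * x) % n ≡ (d * (x % r)) % n
  reduce x = begin
    (d * x) % n                          ≡⟨ cong (λ z → (d * z) % n) (m≡m%n+[m/n]*n x r) ⟩
    (d * (x % r + x / r * r)) % n        ≡⟨ cong (_% n) (expand d r (x % r) (x / r)) ⟩
    (d * (x % r) + x / r * (d * r)) % n  ≡⟨ %-remove-+ʳ (d * (x % r)) (∣n⇒∣m*n (x / r) n∣dr) ⟩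
    (d * (x % r)) % n                    ∎

mismatch : Bool → Bool → ℕ
mismatch true  true  = 0
mismatch false false = 0
mismatch true  false = 1
mismatch false true  = 1

ham : ∀ {m} → Vec Bool m → Vec Bool m → ℕ
ham []       []       = 0
ham (x ∷ xs) (y ∷ ys) = mismatch x y + ham xs ys

count1 : Bool → ℕ
count1 true  = 1
count1 false = 0

ones : ∀ {m} → Vec Bool m → ℕ
ones []       = 0
ones (x ∷ xs) = count1 x + ones xs

ham≤length : ∀ {m} (a b : Vec Bool m) → ham a b ≤ m
ham≤length []      []      = z≤n
ham≤length (x ∷ a) (y ∷ b) = +-mono-≤ (mismatch≤1 x y) (ham≤length a b)
  where
  mismatch≤1 : ∀ x y → mismatch x y ≤ 1
  mismatch≤1 true  true  = z≤n
  mismatch≤1 false false = z≤n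
  mismatch≤1 true  false = s≤s z≤n
  mismatch≤1 false true  = s≤s z≤n

ham-self : ∀ {m} (a : Vec Bool m) → ham a a ≡ 0
ham-self []          = refl
ham-self (true  ∷ a) = ham-self a
ham-self (false ∷ a) = ham-self a

ones-replicate-true : ∀ m → ones (replicate m true) ≡ m
ones-replicate-true zero    = refl
ones-replicate-true (suc m) = cong suc (ones-replicate-true m)

ones-replicate-false : ∀ m → ones (replicate m false) ≡ 0
ones-replicate-false zero    = refl
ones-replicate-false (suc m) = ones-replicate-false m

ham-flip : ∀ {m} (a b : Vec Bool m) p → ¬ lookup a p ≡ lookup b p → suc (ham (flipAt a p) b) ≡ ham a b
ham-flip (x ∷ a) (y ∷ b) zero x≢y = cong (_+ ham a b) (flip-mismatch x y x≢y)
  where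
  flip-mismatch : ∀ x y → ¬ x ≡ y → suc (mismatch (not x) y) ≡ mismatch x y
  flip-mismatch true  true  x≢y = ⊥-elim (x≢y refl)
  flip-mismatch true  false _   = refl
  flip-mismatch false true  _   = refl
  flip-mismatch false false x≢y = ⊥-elim (x≢y refl)
ham-flip (x ∷ a) (y ∷ b) (suc p) a≢b =
  trans (sym (+-suc (mismatch x y) _)) (cong (mismatch x y +_) (ham-flip a b p a≢b))

ones-flip : ∀ {m} (a : Vec Bool m) p → ones (flipAt a p) ≤ suc (ones a)
ones-flip (true  ∷ a) zero    = m≤n⇒m≤1+n (n≤1+n (ones a))
ones-flip (false ∷ a) zero    = ≤-refl
ones-flip (x ∷ a)     (suc p) =
  subst (count1 x + ones (flipAt a p) ≤_) (+-suc (count1 x) (ones a)) (+-monoʳ-≤ (count1 x) (ones-flip a p))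

vec-ext : ∀ {m} {a b : Vec Bool m} → (∀ p → lookup a p ≡ lookup b p) → a ≡ b
vec-ext {a = a} {b} same =
  trans (sym (tabulate∘lookup a)) (trans (tabulate-cong same) (tabulate∘lookup b))

not-≢ : ∀ {x y} → ¬ x ≡ y → not x ≡ y
not-≢ {true}  {true}  x≢y = ⊥-elim (x≢y refl)
not-≢ {true}  {false} _   = refl
not-≢ {false} {true}  _   = refl
not-≢ {false} {false} x≢y = ⊥-elim (x≢y refl)

double-⌊/2⌋≤ : ∀ m → ⌊ m /2⌋ + ⌊ m /2⌋ ≤ m
double-⌊/2⌋≤ zero          = z≤n
double-⌊/2⌋≤ (suc zero)    = z≤n
double-⌊/2⌋≤ (suc (suc m)) =
  s≤s (subst (_≤ suc m) (sym (+-suc ⌊ m /2⌋ ⌊ m /2⌋)) (s≤s (double-⌊/2⌋≤ m)))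

≤1+double-⌊/2⌋ : ∀ m → m ≤ suc (⌊ m /2⌋ + ⌊ m /2⌋)
≤1+double-⌊/2⌋ zero          = z≤n
≤1+double-⌊/2⌋ (suc zero)    = ≤-refl
≤1+double-⌊/2⌋ (suc (suc m)) =
  s≤s (s≤s (subst (m ≤_) (sym (+-suc ⌊ m /2⌋ ⌊ m /2⌋)) (≤1+double-⌊/2⌋ m)))

⌊3m/2⌋≡m+⌊m/2⌋ : ∀ m → ⌊ 3 * m /2⌋ ≡ m + ⌊ m /2⌋
⌊3m/2⌋≡m+⌊m/2⌋ m = trans (cong ⌊_/2⌋ (triple m)) (halve m m)
  where
  triple : ∀ m → 3 * m ≡ m + m + m
  triple = solve-∀
  halve : ∀ k x → ⌊ (k + k + x) /2⌋ ≡ k + ⌊ x /2⌋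
  halve zero    x = refl
  halve (suc k) x = trans (cong ⌊_/2⌋ (regroup k x)) (cong suc (halve k x))
    where
    regroup : ∀ k x → suc k + suc k + x ≡ suc (suc (k + k + x))
    regroup = solve-∀

∣-∣-suc : ∀ s L → ∣ s - L ∣ ≤ suc ∣ suc s - L ∣ × ∣ suc s - L ∣ ≤ suc ∣ s - L ∣
∣-∣-suc s L = subst (λ z → ∣ s - L ∣ ≤ z + ∣ suc s - L ∣) (neighbours s) (∣-∣-triangle s (suc s) L)
            , subst (λ z → ∣ suc s - L ∣ ≤ z + ∣ s - L ∣) (trans (∣-∣-comm (suc s) s) (neighbours s))
                    (∣-∣-triangle (suc s) s L)
  where
  neighbours : ∀ s → ∣ s - suc s ∣ ≡ 1
  neighbours zero    = refl
  neighbours (suc s) = neighbours s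

pay-step : ∀ {k e e′} → e ≤ suc e′ → k + e ≤ suc k + e′
pay-step {k} {e} {e′} e≤1+e′ = subst (k + e ≤_) (+-suc k e′) (+-monoʳ-≤ k e≤1+e′)

∣suc-∣ : ∀ {s L} → L ≤ s → ∣ suc s - L ∣ ≡ suc ∣ s - L ∣
∣suc-∣ {s} {L} L≤s = begin
  ∣ suc s - L ∣  ≡⟨ m≤n⇒∣n-m∣≡n∸m (m≤n⇒m≤1+n L≤s) ⟩
  suc s ∸ L      ≡⟨ +-∸-assoc 1 L≤s ⟩
  suc (s ∸ L)    ≡⟨ cong suc (m≤n⇒∣n-m∣≡n∸m L≤s) ⟨
  suc ∣ s - L ∣  ∎
  where open ≡-Reasoning

signed-difference : ∀ {Y L s} r .{{_ : NonZero r}} → (Y + L) % r ≡ s % r →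
                    (∣ s - L ∣ % r ≡ Y % r) ⊎ ((Y + ∣ s - L ∣) % r ≡ 0)
signed-difference {Y} {L} {s} r Y+L≡s with ≤-total L s
... | inj₁ L≤s with m≤n⇒∃[o]m+o≡n L≤s
...   | e , refl =
  inj₁ (trans (cong (_% r) distance) (sym (%-cancel-+ʳ L r (trans Y+L≡s (cong (_% r) (+-comm L e))))))
  where
  distance : ∣ L + e - L ∣ ≡ e
  distance = trans (∣-∣-comm (L + e) L) (∣m-m+n∣≡n L e)
signed-difference {Y} {L} {s} r Y+L≡s | inj₂ s≤L with m≤n⇒∃[o]m+o≡n s≤L
...   | e , refl = inj₂ (trans (cong (λ z → (Y + z) % r) (∣m-m+n∣≡n s e))
                               (trans (%-cancel-+ʳ s r (trans (cong (_% r) (regroup Y s e)) Y+L≡s))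
                                      (m<n⇒m%n≡m (>-nonZero⁻¹ r))))
  where
  regroup : ∀ y s e → y + e + s ≡ y + (s + e)
  regroup = solve-∀

zero-residue : ∀ {e} r .{{_ : NonZero r}} → (e % r ≡ 0 % r) ⊎ ((0 + e) % r ≡ 0) → e % r ≡ 0
zero-residue r (inj₁ e≡0) = trans e≡0 (m<n⇒m%n≡m (>-nonZero⁻¹ r))
zero-residue r (inj₂ e≡0) = e≡0

±t-residues : ∀ r .{{_ : NonZero r}} t e → 1 ≤ t → t + t ≤ r →
              (e % r ≡ t % r) ⊎ ((t + e) % r ≡ 0) → e ≡ t ⊎ (t + e ≡ r ⊎ r + t ≤ e)
±t-residues r t e 1≤t 2t≤r = classify
  where
  t%r≡t : t % r ≡ t
  t%r≡t = m<n⇒m%n≡m (<-≤-trans (m<m+n t 1≤t) 2t≤r)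
  regroup : ∀ t r → t + (r + t) ≡ r + (t + t)
  regroup = solve-∀
  open ≤-Reasoning
  classify : (e % r ≡ t % r) ⊎ ((t + e) % r ≡ 0) → e ≡ t ⊎ (t + e ≡ r ⊎ r + t ≤ e)
  classify (inj₁ e≡t) with e / r in q
  ... | zero   = inj₁ (trans (div-mod-form r (trans e≡t t%r≡t) q) (+-identityʳ t))
  ... | suc q′ = inj₂ (inj₂ (begin
    r + t            ≡⟨ +-comm r t ⟩
    t + r            ≤⟨ +-monoʳ-≤ t (m≤m+n r (q′ * r)) ⟩
    t + suc q′ * r   ≡⟨ div-mod-form r (trans e≡t t%r≡t) q ⟨
    e                ∎))
  classify (inj₂ t+e≡0) with (t + e) / r in q
  ... | zero         = ⊥-elim (<⇒≱ 1≤t (≤-trans (m≤m+n t e) (≤-reflexive (div-mod-form r t+e≡0 q))))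
  ... | suc zero     = inj₂ (inj₁ (trans (div-mod-form r t+e≡0 q) (+-identityʳ r)))
  ... | suc (suc q′) = inj₂ (inj₂ (+-cancelˡ-≤ t (r + t) e (begin
    t + (r + t)           ≡⟨ regroup t r ⟩
    r + (t + t)           ≤⟨ +-monoʳ-≤ r 2t≤r ⟩
    r + r                 ≤⟨ m≤m+n (r + r) (q′ * r) ⟩
    r + r + q′ * r        ≡⟨ +-assoc r r (q′ * r) ⟩
    0 + suc (suc q′) * r  ≡⟨ div-mod-form r t+e≡0 q ⟨
    t + e                 ∎)))

±t-residue-≥ : ∀ {r t e} → t + t ≤ r → e ≡ t ⊎ (t + e ≡ r ⊎ r + t ≤ e) → t ≤ e
±t-residue-≥ 2t≤r (inj₁ e≡t)          = ≤-reflexive (sym e≡t)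
±t-residue-≥ 2t≤r (inj₂ (inj₁ t+e≡r)) = +-cancelˡ-≤ _ _ _ (≤-trans 2t≤r (≤-reflexive (sym t+e≡r)))
±t-residue-≥ 2t≤r (inj₂ (inj₂ r+t≤e)) = ≤-trans (m≤n+m _ _) r+t≤e

-- The counting behind the bound n + r + ⌊r/2⌋ − 2: a walk of length k sweeping a window of
-- width W ≥ r − 1 with net displacement e pays n + 2W ≤ k + e, and n + e ≤ k; for e ∈ {t, r − t}
-- the first estimate and for e ≥ r + t the second gives n + r + t ≤ k + 2.
tight-bound : ∀ {n r t W e k} → t + t ≤ r → r ≤ suc W → n + (W + W) ≤ k + e → n + e ≤ k →
              e ≡ t ⊎ (t + e ≡ r ⊎ r + t ≤ e) → n + (r + t) ≤ k + 2
tight-bound {n} {r} {t} {W} {e} {k} 2t≤r r≤1+W budget _ (inj₁ e≡t) =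
  +-cancelʳ-≤ t (n + (r + t)) (k + 2) (begin
    n + (r + t) + t      ≡⟨ shuffle n r t ⟩
    n + r + (t + t)      ≤⟨ +-monoʳ-≤ (n + r) 2t≤r ⟩
    n + r + r            ≡⟨ +-assoc n r r ⟩
    n + (r + r)          ≤⟨ +-monoʳ-≤ n (+-mono-≤ r≤1+W r≤1+W) ⟩
    n + (suc W + suc W)  ≡⟨ widen n W ⟩
    n + (W + W) + 2      ≤⟨ +-monoˡ-≤ 2 budget ⟩
    k + e + 2            ≡⟨ cong (λ z → k + z + 2) e≡t ⟩
    k + t + 2            ≡⟨ regroup k t ⟩
    k + 2 + t            ∎)
  where
  open ≤-Reasoning
  shuffle : ∀ n r t → n + (r + t) + t ≡ n + r + (t + t)
  shuffle = solve-∀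
  widen : ∀ n w → n + (suc w + suc w) ≡ n + (w + w) + 2
  widen = solve-∀
  regroup : ∀ k t → k + t + 2 ≡ k + 2 + t
  regroup = solve-∀
tight-bound {n} {r} {t} {W} {e} {k} 2t≤r r≤1+W budget _ (inj₂ (inj₁ t+e≡r)) =
  +-cancelʳ-≤ r (n + (r + t)) (k + 2) (begin
    n + (r + t) + r          ≡⟨ shuffle n r t ⟩
    n + (r + r) + t          ≤⟨ +-monoˡ-≤ t (+-monoʳ-≤ n (+-mono-≤ r≤1+W r≤1+W)) ⟩
    n + (suc W + suc W) + t  ≡⟨ widen n W t ⟩
    n + (W + W) + (2 + t)    ≤⟨ +-monoˡ-≤ (2 + t) budget ⟩
    k + e + (2 + t)          ≡⟨ regroup k e t ⟩
    k + 2 + (t + e)          ≡⟨ cong (k + 2 +_) t+e≡r ⟩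
    k + 2 + r                ∎)
  where
  open ≤-Reasoning
  shuffle : ∀ n r t → n + (r + t) + r ≡ n + (r + r) + t
  shuffle = solve-∀
  widen : ∀ n w t → n + (suc w + suc w) + t ≡ n + (w + w) + (2 + t)
  widen = solve-∀
  regroup : ∀ k e t → k + e + (2 + t) ≡ k + 2 + (t + e)
  regroup = solve-∀
tight-bound {n} {k = k} _ _ _ n+e≤k (inj₂ (inj₂ r+t≤e)) =
  ≤-trans (+-monoʳ-≤ n r+t≤e) (≤-trans n+e≤k (m≤m+n k 2))

ceilDiv-covers : ∀ m k .{{_ : NonZero k}} → m ≤ k * ceilDiv m k
ceilDiv-covers m k = subst (m ≤_) (*-comm c k) (+-cancelʳ-≤ (pred k) m (c * k) (begin
  m + pred k                  ≡⟨ m≡m%n+[m/n]*n (m + pred k) k ⟩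
  (m + pred k) % k + c * k    ≤⟨ +-monoˡ-≤ (c * k) (<⇒≤pred (m%n<n (m + pred k) k)) ⟩
  pred k + c * k              ≡⟨ +-comm (pred k) (c * k) ⟩
  c * k + pred k              ∎))
  where
  open ≤-Reasoning
  c = ceilDiv m k

ceilDiv-least : ∀ m k c .{{_ : NonZero k}} → m ≤ k * c → ceilDiv m k ≤ c
ceilDiv-least m k c m≤kc = <⇒≤pred (m<n*o⇒m/o<n {m + pred k} {suc c} {k} (begin-strict
  m + pred k   <⟨ +-monoʳ-< m (subst (pred k <_) (suc-pred k) ≤-refl) ⟩
  m + k        ≤⟨ +-monoˡ-≤ k m≤kc ⟩
  k * c + k    ≡⟨ +-comm (k * c) k ⟩
  k + k * c    ≡⟨ *-suc k c ⟨
  k * suc c    ≡⟨ *-comm k (suc c) ⟩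
  suc c * k    ∎))
  where open ≤-Reasoning

ceilDiv-pos : ∀ m k .{{_ : NonZero m}} .{{_ : NonZero k}} → 1 ≤ ceilDiv m k
ceilDiv-pos m k =
  m≥n⇒m/n>0 {m + pred k} {k} (subst (_≤ m + pred k) (suc-pred k) (+-monoˡ-≤ (pred k) (>-nonZero⁻¹ m)))

double-pred : ∀ w → 2 * suc w ∸ 2 ≡ w + w
double-pred w = cong (_∸ 2) (expand w)
  where
  expand : ∀ w → 2 * suc w ≡ 2 + (w + w)
  expand = solve-∀

2ceilDiv∸2≤ : ∀ m k W .{{_ : NonZero k}} → m ≤ k * suc W → 2 * ceilDiv m k ∸ 2 ≤ W + W
2ceilDiv∸2≤ m k W m≤k[W+1] = subst (2 * ceilDiv m k ∸ 2 ≤_) (double-pred W)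
  (∸-monoˡ-≤ 2 (*-monoʳ-≤ 2 (ceilDiv-least m k (suc W) m≤k[W+1])))

≤1+W⇒≤2W : ∀ {r W} → 2 ≤ r → r ≤ suc W → r ≤ W + W
≤1+W⇒≤2W {W = zero}  2≤r r≤1 = ⊥-elim (<⇒≱ (s≤s (s≤s z≤n)) (≤-trans 2≤r r≤1))
≤1+W⇒≤2W {W = suc W} _   r≤2+W =
  ≤-trans r≤2+W (s≤s (subst (suc W ≤_) (sym (+-suc W W)) (s≤s (m≤m+n W W))))

data Dir : Set where
  forward backward : Dir

reverse : Dir → Dir
reverse forward  = backward
reverse backward = forward

module Ring (r : ℕ) .{{_ : NonZero r}} where

  step : Dir → Fin r → Fin r
  step forward  = succR r
  step backward = predR r

  steps : Dir → ℕ → Fin r → Fin r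
  steps dir zero    x = x
  steps dir (suc m) x = step dir (steps dir m x)

  toℕ+r : ∀ (x : Fin r) → (toℕ x + r) % r ≡ toℕ x
  toℕ+r x = trans ([m+n]%n≡m%n (toℕ x) r) (m<n⇒m%n≡m (toℕ<n x))

  suc+pred : ∀ a → suc a + pred r ≡ a + r
  suc+pred a = trans (sym (+-suc a (pred r))) (cong (a +_) (suc-pred r))

  step-reverse : ∀ dir x → step (reverse dir) (step dir x) ≡ x
  step-reverse forward x = toℕ-injective (begin
    toℕ (predR r (succR r x))       ≡⟨ toℕ-fromℕ< _ ⟩
    (toℕ (succR r x) + pred r) % r  ≡⟨ cong (λ z → (z + pred r) % r) (toℕ-fromℕ< _) ⟩
    (suc (toℕ x) % r + pred r) % r  ≡⟨ %-reduceˡ (suc (toℕ x)) (pred r) r ⟩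
    (suc (toℕ x) + pred r) % r      ≡⟨ cong (_% r) (suc+pred (toℕ x)) ⟩
    (toℕ x + r) % r                 ≡⟨ toℕ+r x ⟩
    toℕ x                           ∎)
    where open ≡-Reasoning
  step-reverse backward x = toℕ-injective (begin
    toℕ (succR r (predR r x))       ≡⟨ toℕ-fromℕ< _ ⟩
    suc (toℕ (predR r x)) % r       ≡⟨ cong (λ z → suc z % r) (toℕ-fromℕ< _) ⟩
    (1 + (toℕ x + pred r) % r) % r  ≡⟨ %-reduceʳ 1 (toℕ x + pred r) r ⟩
    (suc (toℕ x) + pred r) % r      ≡⟨ cong (_% r) (suc+pred (toℕ x)) ⟩
    (toℕ x + r) % r                 ≡⟨ toℕ+r x ⟩
    toℕ x                           ∎)
    where open ≡-Reasoning

  steps-+ : ∀ dir p q x → steps dir (p + q) x ≡ steps dir p (steps dir q x)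
  steps-+ dir zero    q x = refl
  steps-+ dir (suc p) q x = cong (step dir) (steps-+ dir p q x)

  steps-step : ∀ dir m x → steps dir m (step dir x) ≡ step dir (steps dir m x)
  steps-step dir zero    x = refl
  steps-step dir (suc m) x = cong (step dir) (steps-step dir m x)

  steps-reverse : ∀ dir m x → steps (reverse dir) m (steps dir m x) ≡ x
  steps-reverse dir zero    x = refl
  steps-reverse dir (suc m) x = begin
    step (reverse dir) (steps (reverse dir) m (step dir (steps dir m x)))
      ≡⟨ steps-step (reverse dir) m _ ⟨
    steps (reverse dir) m (step (reverse dir) (step dir (steps dir m x)))
      ≡⟨ cong (steps (reverse dir) m) (step-reverse dir _) ⟩
    steps (reverse dir) m (steps dir m x)
      ≡⟨ steps-reverse dir m x ⟩
    x ∎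
    where open ≡-Reasoning

  steps-reverse′ : ∀ dir m x → steps dir m (steps (reverse dir) m x) ≡ x
  steps-reverse′ forward  = steps-reverse backward
  steps-reverse′ backward = steps-reverse forward

  toℕ-steps-forward : ∀ t x → toℕ (steps forward t x) ≡ (toℕ x + t) % r
  toℕ-steps-forward zero x = sym (trans (cong (_% r) (+-identityʳ (toℕ x))) (m<n⇒m%n≡m (toℕ<n x)))
  toℕ-steps-forward (suc t) x = begin
    toℕ (succR r (steps forward t x))  ≡⟨ toℕ-fromℕ< _ ⟩
    (1 + toℕ (steps forward t x)) % r  ≡⟨ cong (λ z → (1 + z) % r) (toℕ-steps-forward t x) ⟩
    (1 + (toℕ x + t) % r) % r          ≡⟨ %-reduceʳ 1 (toℕ x + t) r ⟩
    suc (toℕ x + t) % r                ≡⟨ cong (_% r) (+-suc (toℕ x) t) ⟨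
    (toℕ x + suc t) % r                ∎
    where open ≡-Reasoning

  steps-r : ∀ dir x → steps dir r x ≡ x
  steps-r forward  x = toℕ-injective (trans (toℕ-steps-forward r x) (toℕ+r x))
  steps-r backward x =
    trans (cong (steps backward r) (sym (steps-r forward x))) (steps-reverse forward r x)

  steps-complement : ∀ dir δ {x y} → δ ≤ r → steps dir δ x ≡ y → steps (reverse dir) (r ∸ δ) x ≡ y
  steps-complement dir δ {x} {y} δ≤r reach = begin
    back ε x                              ≡⟨ cong (back ε) (steps-r dir x) ⟨
    back ε (steps dir r x)                ≡⟨ cong (λ z → back ε (steps dir z x)) (m∸n+n≡m δ≤r) ⟨
    back ε (steps dir (ε + δ) x)          ≡⟨ cong (back ε) (steps-+ dir ε δ x) ⟩
    back ε (steps dir ε (steps dir δ x))  ≡⟨ steps-reverse dir ε _ ⟩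
    steps dir δ x                         ≡⟨ reach ⟩
    y                                     ∎
    where
    open ≡-Reasoning
    ε = r ∸ δ
    back = steps (reverse dir)

  forwardDist : Fin r → Fin r → ℕ
  forwardDist x y = (toℕ y + (r ∸ toℕ x)) % r

  steps-forwardDist : ∀ x y → steps forward (forwardDist x y) x ≡ y
  steps-forwardDist x y = toℕ-injective (begin
    toℕ (steps forward (forwardDist x y) x)    ≡⟨ toℕ-steps-forward _ x ⟩
    (X + (Y + (r ∸ X)) % r) % r                ≡⟨ %-reduceʳ X _ r ⟩
    (X + (Y + (r ∸ X))) % r                    ≡⟨ cong (_% r) (regroup X Y (r ∸ X)) ⟩
    (Y + (X + (r ∸ X))) % r                    ≡⟨ cong (λ z → (Y + z) % r) (m+[n∸m]≡n X≤r) ⟩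
    (Y + r) % r                                ≡⟨ toℕ+r y ⟩
    Y                                          ∎)
    where
    open ≡-Reasoning
    X = toℕ x
    Y = toℕ y
    X≤r = <⇒≤ (toℕ<n x)
    regroup : ∀ a b c → a + (b + c) ≡ b + (a + c)
    regroup = solve-∀

  nearest : ∀ x y → ∃[ dir ] ∃[ δ ] (δ ≤ ⌊ r /2⌋ × steps dir δ x ≡ y)
  nearest x y with forwardDist x y ≤? ⌊ r /2⌋
  ... | yes close = forward , forwardDist x y , close , steps-forwardDist x y
  ... | no far    = backward , r ∸ forwardDist x y , backward-close ,
                    steps-complement forward _ (<⇒≤ (m%n<n _ r)) (steps-forwardDist x y)
    where
    backward-close : r ∸ forwardDist x y ≤ ⌊ r /2⌋
    backward-close =
      ≤-trans (∸-monoʳ-≤ r (≰⇒> far)) (m≤n+o⇒m∸n≤o r (suc ⌊ r /2⌋) (≤1+double-⌊/2⌋ r))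

module Graph (n d r : ℕ) .{{_ : NonZero n}} .{{_ : NonZero d}} .{{_ : NonZero r}} (n∣dr : n ∣ d * r) where
  open Ring r public

  Reach≤ : Vertex n r → Vertex n r → ℕ → Set
  Reach≤ u v D = ∃[ k ] (k ≤ D × Walk n d r u v k)

  weaken : ∀ {u v D D′} → D ≤ D′ → Reach≤ u v D → Reach≤ u v D′
  weaken D≤D′ (k , k≤D , w) = k , ≤-trans k≤D D≤D′ , w

  _++ʷ_ : ∀ {u v w k l} → Walk n d r u v k → Walk n d r v w l → Walk n d r u w (k + l)
  nil      ++ʷ q = q
  cons e p ++ʷ q = cons e (p ++ʷ q)

  ringEdge : ∀ dir a x → Adj n d r (a , x) (a , step dir x)
  ringEdge forward  = fwd
  ringEdge backward = bwd

  ringWalk : ∀ dir m a x → Walk n d r (a , x) (a , steps dir m x) m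
  ringWalk dir zero    a x = nil
  ringWalk dir (suc m) a x = cons (ringEdge dir a x)
    (subst (λ z → Walk n d r (a , step dir x) (a , z) m) (steps-step dir m x)
           (ringWalk dir m a (step dir x)))

  +d*-cong : ∀ c {a b} → a % r ≡ b % r → (c + d * a) % n ≡ (c + d * b) % n
  +d*-cong c {a} {b} a≡b = begin
    (c + d * a) % n        ≡⟨ %-reduceʳ c (d * a) n ⟨
    (c + (d * a) % n) % n  ≡⟨ cong (λ z → (c + z) % n) (d*-mod {n} {d} {r} n∣dr a≡b) ⟩
    (c + (d * b) % n) % n  ≡⟨ %-reduceʳ c (d * b) n ⟩
    (c + d * b) % n        ∎
    where open ≡-Reasoning

  cubePos-congruence : ∀ (j : Fin d) (x : Fin r) {a b} → (toℕ x + a) % r ≡ b % r →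
                       (d * b + toℕ j) % n ≡ (toℕ (cubePos n d j x) + d * a) % n
  cubePos-congruence j x {a} {b} x+a≡b = sym (begin
    (toℕ (cubePos n d j x) + d * a) % n  ≡⟨ cong (λ z → (z + d * a) % n) (toℕ-fromℕ< _) ⟩
    ((J + d * X) % n + d * a) % n        ≡⟨ %-reduceˡ (J + d * X) (d * a) n ⟩
    (J + d * X + d * a) % n              ≡⟨ cong (_% n) (factor J d X a) ⟩
    (J + d * (X + a)) % n                ≡⟨ +d*-cong J x+a≡b ⟩
    (J + d * b) % n                      ≡⟨ cong (_% n) (+-comm J (d * b)) ⟩
    (d * b + J) % n                      ∎)
    where
    open ≡-Reasoning
    J = toℕ j
    X = toℕ x
    factor : ∀ j d x a → j + d * x + d * a ≡ j + d * (x + a)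
    factor = solve-∀

  Hit : Fin r → Fin n → Set
  Hit x q = ∃[ j ] cubePos n d j x ≡ q

  Swept : Dir → ℕ → Fin r → Fin n → Set
  Swept dir m x q = ∃[ i ] (i ≤ m × Hit (steps dir i x) q)

  cover-forward : ∀ m → n ≤ d * suc m → ∀ x p → Swept forward m x p
  cover-forward m cov x p = i , i≤m , j , toℕ-injective hits
    where
    X = toℕ x
    P = toℕ p
    q = (P + (n ∸ (d * X) % n)) % n
    i = q / d
    j = fromℕ< (m%n<n q d)
    i≤m : i ≤ m
    i≤m = <⇒≤pred (m<n*o⇒m/o<n {q} {suc m} {d}
                     (≤-trans (m%n<n _ n) (subst (n ≤_) (*-comm d (suc m)) cov)))
    open ≡-Reasoning
    split : q % d + d * (X + i) ≡ q + d * X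
    split = begin
      q % d + d * (X + i)        ≡⟨ regroup (q % d) d X i ⟩
      (q % d + i * d) + d * X    ≡⟨ cong (_+ d * X) (m≡m%n+[m/n]*n q d) ⟨
      q + d * X                  ∎
      where
      regroup : ∀ a d x i → a + d * (x + i) ≡ (a + i * d) + d * x
      regroup = solve-∀
    hits : toℕ (cubePos n d j (steps forward i x)) ≡ P
    hits = begin
      toℕ (cubePos n d j (steps forward i x))          ≡⟨ toℕ-fromℕ< _ ⟩
      (toℕ j + d * toℕ (steps forward i x)) % n        ≡⟨ cong₂ (λ u v → (u + d * v) % n)
                                                                (toℕ-fromℕ< _) (toℕ-steps-forward i x) ⟩
      (q % d + d * ((X + i) % r)) % n                  ≡⟨ +d*-cong (q % d) (m%n%n≡m%n (X + i) r) ⟩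
      (q % d + d * (X + i)) % n                        ≡⟨ cong (_% n) split ⟩
      (q + d * X) % n                                  ≡⟨ %-add-complement P (d * X) n ⟩
      P % n                                            ≡⟨ m<n⇒m%n≡m (toℕ<n p) ⟩
      P                                                ∎

  -- The same holds backwards, since x, x − 1, …, x − m are the forward positions from x − m.
  cover : ∀ dir m → n ≤ d * suc m → ∀ x p → Swept dir m x p
  cover forward  = cover-forward
  cover backward m cov x p with cover-forward m cov (steps backward m x) p
  ... | i , i≤m , j , hit = m ∸ i , m∸n≤m m i , j , trans (cong (cubePos n d j) same-position) hit
    where
    open ≡-Reasoning
    y = steps backward m x
    same-position : steps backward (m ∸ i) x ≡ steps forward i y
    same-position = begin
      back x                                          ≡⟨ cong back (steps-reverse′ forward m x) ⟨
      back (steps forward m y)                        ≡⟨ cong (λ z → back (steps forward z y)) (m∸n+n≡m i≤m) ⟨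
      back (steps forward (m ∸ i + i) y)              ≡⟨ cong back (steps-+ forward (m ∸ i) i y) ⟩
      back (steps forward (m ∸ i) (steps forward i y)) ≡⟨ steps-reverse forward (m ∸ i) _ ⟩
      steps forward i y                               ∎
      where back = steps backward (m ∸ i)

  module Repair (b : Vec Bool n) where

    -- A walk from (a , x) to (a′ , y) using m ring steps in which every flip corrects a
    -- disagreement with b: its length is m plus the number of corrections.
    record Repaired (a : Vec Bool n) (x y : Fin r) (m : ℕ) (P : Fin n → Set) : Set where
      constructor repaired
      field
        a′    : Vec Bool n
        len   : ℕ
        walk  : Walk n d r (a , x) (a′ , y) len
        cost  : len + ham a′ b ≡ m + ham a b
        keeps : ∀ q → lookup a q ≡ lookup b q → lookup a′ q ≡ lookup b q
        fixes : ∀ q → P q → lookup a′ q ≡ lookup b q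

    fixList : (js : List (Fin d)) → ∀ a x →
              Repaired a x x 0 (λ q → ∃[ j ] (j ∈ js × cubePos n d j x ≡ q))
    fixList [] a x = repaired a 0 nil refl (λ q agree → agree) (λ { q (j , () , _) })
    fixList (j ∷ js) a x with lookup a (cubePos n d j x) ≟ᵇ lookup b (cubePos n d j x)
    ... | yes agree = repaired R.a′ R.len R.walk R.cost R.keeps fixes
      where
      module R = Repaired (fixList js a x)
      fixes : ∀ q → ∃[ j′ ] (j′ ∈ j ∷ js × cubePos n d j′ x ≡ q) → lookup R.a′ q ≡ lookup b q
      fixes q (_ , here refl , refl) = R.keeps _ agree
      fixes q (j′ , there j′∈js , hit) = R.fixes q (j′ , j′∈js , hit)
    ... | no differ = repaired R.a′ (suc R.len) (cons (cube a x j) R.walk)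
                               (trans (cong suc R.cost) (ham-flip a b p differ)) keeps fixes
      where
      p = cubePos n d j x
      module R = Repaired (fixList js (flipAt a p) x)
      keeps : ∀ q → lookup a q ≡ lookup b q → lookup R.a′ q ≡ lookup b q
      keeps q agree with q ≟ᶠ p
      ... | yes refl = ⊥-elim (differ agree)
      ... | no q≢p   = R.keeps q (trans (lookup∘updateAt′ q p q≢p a) agree)
      fixes : ∀ q → ∃[ j′ ] (j′ ∈ j ∷ js × cubePos n d j′ x ≡ q) → lookup R.a′ q ≡ lookup b q
      fixes q (_ , here refl , refl) = R.keeps _ (trans (lookup∘updateAt p a) (not-≢ differ))
      fixes q (j′ , there j′∈js , hit) = R.fixes q (j′ , j′∈js , hit)

    fixHere : ∀ a x → Repaired a x x 0 (Hit x)
    fixHere a x = repaired R.a′ R.len R.walk R.cost R.keeps (λ q (j , hit) → R.fixes q (j , ∈-allFin j , hit))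
      where module R = Repaired (fixList (allFin d) a x)

    sweep : ∀ dir m a x → Repaired a x (steps dir m x) m (Swept dir m x)
    sweep dir zero a x = repaired F.a′ F.len F.walk F.cost F.keeps fixes
      where
      module F = Repaired (fixHere a x)
      fixes : ∀ q → Swept dir 0 x q → lookup F.a′ q ≡ lookup b q
      fixes q (.zero , z≤n , hit) = F.fixes q hit
    sweep dir (suc m) a x = repaired R.a′ (F.len + suc R.len) walk cost keeps fixes
      where
      module F = Repaired (fixHere a x)
      module R = Repaired (sweep dir m F.a′ (step dir x))
      walk = F.walk ++ʷ cons (ringEdge dir F.a′ x)
                        (subst (λ z → Walk n d r (F.a′ , step dir x) (R.a′ , z) R.len) (steps-step dir m x)
                               R.walk)
      cost : F.len + suc R.len + ham R.a′ b ≡ suc m + ham a b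
      cost = begin
        F.len + suc R.len + ham R.a′ b   ≡⟨ regroup F.len R.len (ham R.a′ b) ⟩
        suc (R.len + ham R.a′ b) + F.len ≡⟨ cong (λ z → suc z + F.len) R.cost ⟩
        suc (m + ham F.a′ b) + F.len     ≡⟨ regroup′ m (ham F.a′ b) F.len ⟩
        suc m + (F.len + ham F.a′ b)     ≡⟨ cong (suc m +_) F.cost ⟩
        suc m + ham a b                  ∎
        where
        open ≡-Reasoning
        regroup : ∀ a b c → a + suc b + c ≡ suc (b + c) + a
        regroup = solve-∀
        regroup′ : ∀ a b c → suc (a + b) + c ≡ suc a + (c + b)
        regroup′ = solve-∀
      keeps : ∀ q → lookup a q ≡ lookup b q → lookup R.a′ q ≡ lookup b q
      keeps q agree = R.keeps q (F.keeps q agree)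
      fixes : ∀ q → Swept dir (suc m) x q → lookup R.a′ q ≡ lookup b q
      fixes q (zero , _ , hit) = R.keeps q (F.fixes q hit)
      fixes q (suc i , s≤s i≤m , j , hit) =
        R.fixes q (i , i≤m , j , trans (cong (cubePos n d j) (steps-step dir i x)) hit)

    repairWalk : ∀ dir m → n ≤ d * suc m → ∀ a x → Walk n d r (a , x) (b , steps dir m x) (m + ham a b)
    repairWalk dir m cov a x =
      subst₂ (λ v k → Walk n d r (a , x) (v , steps dir m x) k) a′≡b len≡ S.walk
      where
      module S = Repaired (sweep dir m a x)
      a′≡b : S.a′ ≡ b
      a′≡b = vec-ext (λ q → S.fixes q (cover dir m cov x q))
      len≡ : S.len ≡ m + ham a b
      len≡ = trans (sym (+-identityʳ S.len))
                   (trans (cong (S.len +_) (sym (trans (cong (λ v → ham v b) a′≡b) (ham-self b)))) S.cost)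

  open Repair using (repairWalk)

  -- To reach (b , y) with y = x moved δ steps along dir: go α steps the other way, then sweep
  -- δ + α steps along dir.  This costs at most α + (δ + α) + n once δ + α + 1 positions cover Z_n.
  route : ∀ dir δ α → n ≤ d * suc (δ + α) → ∀ a b {x y} → steps dir δ x ≡ y →
          Reach≤ (a , x) (b , y) (α + (δ + α) + n)
  route dir δ α cov a b {x} {y} reach =
    α + (δ + α + ham a b) , bound ,
    (ringWalk (reverse dir) α a x ++ʷ
     subst (λ z → Walk n d r (a , x′) (b , z) _) arrives (repairWalk b dir (δ + α) cov a x′))
    where
    x′ = steps (reverse dir) α x
    arrives : steps dir (δ + α) x′ ≡ y
    arrives = trans (steps-+ dir δ α x′) (trans (cong (steps dir δ) (steps-reverse′ dir α x)) reach)
    bound : α + (δ + α + ham a b) ≤ α + (δ + α) + n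
    bound = subst (_≤ α + (δ + α) + n) (+-assoc α (δ + α) (ham a b))
                  (+-monoʳ-≤ (α + (δ + α)) (ham≤length a b))

  +n-mono : ∀ {a b} → a ≤ b → a + n ≤ n + b
  +n-mono {a} {b} a≤b = subst (_≤ n + b) (+-comm n a) (+-monoʳ-≤ n a≤b)

  -- If n ≤ d (K+1), every pair of vertices is at distance at most n + max(⌊r/2⌋, 2K):
  -- take the nearer ring direction and, if needed, back up until K+1 positions are swept.
  upper-bound-window : ∀ K → n ≤ d * suc K → ∀ u v → Reach≤ u v (n + (⌊ r /2⌋ ⊔ (K + K)))
  upper-bound-window K cov (a , x) (b , y) with nearest x y
  ... | dir , δ , δ≤t , reach with δ ≤? K
  ...   | yes δ≤K = weaken (+n-mono (≤-trans back-and-forth (m≤n⊔m ⌊ r /2⌋ (K + K))))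
                           (route dir δ (K ∸ δ) (subst (λ z → n ≤ d * suc z) (sym δ+α≡K) cov) a b reach)
    where
    δ+α≡K : δ + (K ∸ δ) ≡ K
    δ+α≡K = m+[n∸m]≡n δ≤K
    back-and-forth : K ∸ δ + (δ + (K ∸ δ)) ≤ K + K
    back-and-forth = subst (λ z → K ∸ δ + z ≤ K + K) (sym δ+α≡K) (+-monoˡ-≤ K (m∸n≤m K δ))
  ...   | no δ≰K = weaken (+n-mono straight) (route dir δ 0 enough a b reach)
    where
    enough : n ≤ d * suc (δ + 0)
    enough = ≤-trans cov (*-monoʳ-≤ d (s≤s (subst (K ≤_) (sym (+-identityʳ δ)) (<⇒≤ (≰⇒> δ≰K)))))
    straight : δ + 0 ≤ ⌊ r /2⌋ ⊔ (K + K)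
    straight = subst (_≤ ⌊ r /2⌋ ⊔ (K + K)) (sym (+-identityʳ δ))
                     (≤-trans δ≤t (m≤m⊔n ⌊ r /2⌋ (K + K)))

  -- If n ≤ d r, every pair of vertices is at distance at most n + B whenever r ≤ B and
  -- r + ⌊r/2⌋ ∸ 2 ≤ B: a full turn reaches the same ring position, and a position δ ≥ 1
  -- steps away is reached by backing up δ − 1 steps and sweeping r − 1 steps the other way.
  upper-bound-ring : n ≤ d * r → ∀ B → r ≤ B → r + ⌊ r /2⌋ ∸ 2 ≤ B →
                     ∀ u v → Reach≤ u v (n + B)
  upper-bound-ring cov B r≤B detour≤B (a , x) (b , y) with nearest x y
  ... | dir , zero , _ , reach =
        weaken (+n-mono (subst (_≤ B) (sym (+-identityʳ r)) r≤B))
               (route dir r 0 enough a b (trans (steps-r dir x) reach))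
    where
    enough : n ≤ d * suc (r + 0)
    enough = ≤-trans cov (*-monoʳ-≤ d (subst (r ≤_) (cong suc (sym (+-identityʳ r))) (n≤1+n r)))
  ... | dir , suc δ , δ<t , reach =
        weaken (+n-mono (≤-trans detour detour≤B))
               (route (reverse dir) ε δ (subst (λ z → n ≤ d * z) (sym once-round) cov) a b
                      (steps-complement dir (suc δ) δ<r reach))
    where
    δ<r : suc δ ≤ r
    δ<r = ≤-trans δ<t (⌊n/2⌋≤n r)
    ε = r ∸ suc δ
    once-round : suc (ε + δ) ≡ r
    once-round = trans (sym (+-suc ε δ)) (m∸n+n≡m δ<r)
    shuffle : ∀ e δ → suc (e + δ) + suc δ ≡ δ + (e + δ) + 2
    shuffle = solve-∀
    detour : δ + (ε + δ) ≤ r + ⌊ r /2⌋ ∸ 2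
    detour = m+n≤o⇒m≤o∸n _ (subst (_≤ r + ⌊ r /2⌋) r+1+δ≡δ+[ε+δ]+2 (+-monoʳ-≤ r δ<t))
      where
      r+1+δ≡δ+[ε+δ]+2 : r + suc δ ≡ δ + (ε + δ) + 2
      r+1+δ≡δ+[ε+δ]+2 = trans (cong (_+ suc δ) (sym once-round)) (shuffle ε δ)

  -- Unwrapping the ring positions
  -- visited to integers shifted into a window [0 , W], the walk started at L and is now at s.
  -- Every 1-coordinate was flipped at some position u of the window, and the length pays for
  -- each 1-coordinate and for sweeping the window out and back, up to the net displacement.
  FlippedIn : ℕ → ℕ → Fin n → Set
  FlippedIn W L p = ∃[ u ] (u ≤ W × ∃ λ (j : Fin d) → (d * u + toℕ j) % n ≡ (toℕ p + d * L) % n)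

  record Trace (v : Vertex n r) (k : ℕ) : Set where
    constructor trace
    field
      L W s     : ℕ
      L≤W       : L ≤ W
      s≤W       : s ≤ W
      position  : (toℕ (proj₂ v) + L) % r ≡ s % r
      budget    : ones (proj₁ v) + (W + W) ≤ k + ∣ s - L ∣
      flippedAt : ∀ p → lookup (proj₁ v) p ≡ true → FlippedIn W L p

  position-succ : ∀ x {L s} → (toℕ x + L) % r ≡ s % r → (toℕ (succR r x) + L) % r ≡ suc s % r
  position-succ x {L} {s} x+L≡s = begin
    (toℕ (succR r x) + L) % r  ≡⟨ cong (λ z → (z + L) % r) (toℕ-fromℕ< _) ⟩
    (suc (toℕ x) % r + L) % r  ≡⟨ %-reduceˡ (suc (toℕ x)) L r ⟩
    suc (toℕ x + L) % r        ≡⟨ cong (_% r) (+-comm 1 (toℕ x + L)) ⟩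
    (toℕ x + L + 1) % r        ≡⟨ %-cong-+ʳ 1 r x+L≡s ⟩
    (s + 1) % r                ≡⟨ cong (_% r) (+-comm s 1) ⟩
    suc s % r                  ∎
    where open ≡-Reasoning

  position-pred : ∀ x L → (toℕ (predR r x) + suc L) % r ≡ (toℕ x + L) % r
  position-pred x L = begin
    (toℕ (predR r x) + suc L) % r         ≡⟨ cong (λ z → (z + suc L) % r) (toℕ-fromℕ< _) ⟩
    ((toℕ x + pred r) % r + suc L) % r    ≡⟨ %-reduceˡ (toℕ x + pred r) (suc L) r ⟩
    (toℕ x + pred r + suc L) % r          ≡⟨ cong (_% r) (regroup (toℕ x) (pred r) L) ⟩
    (toℕ x + L + suc (pred r)) % r        ≡⟨ cong (λ z → (toℕ x + L + z) % r) (suc-pred r) ⟩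
    (toℕ x + L + r) % r                   ≡⟨ [m+n]%n≡m%n (toℕ x + L) r ⟩
    (toℕ x + L) % r                       ∎
    where
    open ≡-Reasoning
    regroup : ∀ x p l → x + p + suc l ≡ x + l + suc p
    regroup = solve-∀

  -- A cube step flips p; if it creates a 1 there, that 1 was flipped at the current position s.
  trace-cube : ∀ a x j {k} → Trace (a , x) k → Trace (flipAt a (cubePos n d j x) , x) (suc k)
  trace-cube a x j (trace L W s L≤W s≤W position budget flippedAt) =
    trace L W s L≤W s≤W position (≤-trans (+-monoˡ-≤ (W + W) (ones-flip a p)) (s≤s budget)) flippedAt′
    where
    p = cubePos n d j x
    flippedAt′ : ∀ q → lookup (flipAt a p) q ≡ true → FlippedIn W L q
    flippedAt′ q one with q ≟ᶠ p
    ... | yes refl = s , s≤W , j , cubePos-congruence j x position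
    ... | no q≢p   = flippedAt q (trans (sym (lookup∘updateAt′ q p q≢p a)) one)

  -- A forward step inside the window moves s; at its right end it widens the window.
  trace-forward : ∀ a x {k} → Trace (a , x) k → Trace (a , succR r x) (suc k)
  trace-forward a x {k} (trace L W s L≤W s≤W position budget flippedAt) with m≤n⇒m<n∨m≡n s≤W
  ... | inj₁ s<W  = trace L W (suc s) L≤W s<W (position-succ x position)
                      (≤-trans budget (pay-step (proj₁ (∣-∣-suc s L)))) flippedAt
  ... | inj₂ refl = trace L (suc s) (suc s) (m≤n⇒m≤1+n L≤W) ≤-refl (position-succ x position) budget′
                      (λ q one → let u , u≤s , rest = flippedAt q one in u , m≤n⇒m≤1+n u≤s , rest)
    where
    widen : ∀ o s → suc (suc (o + (s + s))) ≡ o + (suc s + suc s)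
    widen = solve-∀
    budget′ : ones a + (suc s + suc s) ≤ suc k + ∣ suc s - L ∣
    budget′ = subst₂ _≤_ (widen (ones a) s)
                     (trans (cong suc (sym (+-suc k _))) (cong (suc k +_) (sym (∣suc-∣ L≤W))))
                     (s≤s (s≤s budget))

  -- A backward step inside the window moves s; at its left end it widens the window and
  -- shifts all window positions, including the offset L, up by one.
  trace-backward : ∀ a x {k} → Trace (a , x) k → Trace (a , predR r x) (suc k)
  trace-backward a x {k} (trace L W (suc s) L≤W s≤W position budget flippedAt) =
    trace L W s L≤W (≤-trans (n≤1+n s) s≤W) position′ (≤-trans budget (pay-step (proj₂ (∣-∣-suc s L))))
          flippedAt
    where
    open ≡-Reasoning
    P = toℕ (predR r x)
    position′ : (P + L) % r ≡ s % r
    position′ = %-cancel-+ʳ 1 r (begin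
      (P + L + 1) % r  ≡⟨ cong (_% r) (trans (+-assoc P L 1) (cong (P +_) (+-comm L 1))) ⟩
      (P + suc L) % r  ≡⟨ position-pred x L ⟩
      (toℕ x + L) % r  ≡⟨ position ⟩
      suc s % r        ≡⟨ cong (_% r) (+-comm 1 s) ⟩
      (s + 1) % r      ∎)
  trace-backward a x {k} (trace L W zero L≤W s≤W position budget flippedAt) =
    trace (suc L) (suc W) zero (s≤s L≤W) z≤n (trans (position-pred x L) position) budget′ shifted
    where
    widen : ∀ o w → suc (suc (o + (w + w))) ≡ o + (suc w + suc w)
    widen = solve-∀
    budget′ : ones a + (suc W + suc W) ≤ suc k + suc L
    budget′ = subst₂ _≤_ (widen (ones a) W) (cong suc (sym (+-suc k L))) (s≤s (s≤s budget))
    shift : ∀ d u j → d * suc u + j ≡ d * u + j + d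
    shift = solve-∀
    shift′ : ∀ q d l → q + d * l + d ≡ q + d * suc l
    shift′ = solve-∀
    shifted : ∀ q → lookup a q ≡ true → FlippedIn (suc W) (suc L) q
    shifted q one with flippedAt q one
    ... | u , u≤W , j , flip≡q = suc u , s≤s u≤W , j , (begin
      (d * suc u + toℕ j) % n  ≡⟨ cong (_% n) (shift d u (toℕ j)) ⟩
      (d * u + toℕ j + d) % n  ≡⟨ %-cong-+ʳ d n flip≡q ⟩
      (toℕ q + d * L + d) % n  ≡⟨ cong (_% n) (shift′ (toℕ q) d L) ⟩
      (toℕ q + d * suc L) % n  ∎)
      where open ≡-Reasoning

  trace-step : ∀ {u v k} → Adj n d r u v → Trace u k → Trace v (suc k)
  trace-step (cube a x j) = trace-cube a x j
  trace-step (fwd a x)    = trace-forward a x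
  trace-step (bwd a x)    = trace-backward a x

  trace-walk : ∀ {u v k l} → Walk n d r u v l → Trace u k → Trace v (k + l)
  trace-walk {k = k} nil         T = subst (Trace _) (sym (+-identityʳ k)) T
  trace-walk {k = k} (cons e w)  T = subst (Trace _) (sym (+-suc k _)) (trace-walk w (trace-step e T))

  origin : Fin r
  origin = fromℕ< (>-nonZero⁻¹ r)

  zeros allOnes : Vec Bool n
  zeros   = replicate n false
  allOnes = replicate n true

  trace-start : Trace (zeros , origin) 0
  trace-start = trace 0 0 0 z≤n z≤n (cong (λ z → (z + 0) % r) (toℕ-fromℕ< _))
                      (subst (λ z → z + 0 ≤ 0) (sym (ones-replicate-false n)) z≤n)
                      (λ p one → ⊥-elim (false≢true (trans (sym (lookup-replicate p false)) one)))
    where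
    false≢true : ¬ false ≡ true
    false≢true ()

  -- If every coordinate is hit by some d u + j (u ≤ W, j < d) up to the common shift d L, then
  -- these d (W+1) values meet every residue modulo n, so n ≤ d (W+1).
  window-bound : ∀ W L → (∀ p → FlippedIn W L p) → n ≤ d * suc W
  window-bound W L flips = from (flips p)
    where
    p : Fin n
    p = fromℕ< (m%n<n (d * suc W + (n ∸ (d * L) % n)) n)
    target : (toℕ p + d * L) % n ≡ (d * suc W) % n
    target = trans (cong (λ z → (z + d * L) % n) (toℕ-fromℕ< _))
                   (%-add-complement (d * suc W) (d * L) n)
    from : FlippedIn W L p → n ≤ d * suc W
    from (u , u≤W , j , hit) = ≤-trans (m≤n+m n (d * u + toℕ j)) (%-gap n below (trans hit target))
      where
      below : d * u + toℕ j < d * suc W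
      below = begin-strict
        d * u + toℕ j  <⟨ +-monoʳ-< (d * u) (toℕ<n j) ⟩
        d * u + d      ≡⟨ +-comm (d * u) d ⟩
        d + d * u      ≡⟨ *-suc d u ⟨
        d * suc u      ≤⟨ *-monoʳ-≤ d (s≤s u≤W) ⟩
        d * suc W      ∎
        where open ≤-Reasoning

  -- What a walk of length k from (0⃗ , 0) to (1⃗ , y), toℕ y = Y, reveals: a window W whose
  -- positions cover Z_n, and a net displacement e ≤ W with e ≡ ±Y (mod r) and n + 2W ≤ k + e.
  record Final (Y k : ℕ) : Set where
    field
      W e     : ℕ
      window  : n ≤ d * suc W
      budget  : n + (W + W) ≤ k + e
      e≤W     : e ≤ W
      residue : (e % r ≡ Y % r) ⊎ ((Y + e) % r ≡ 0)

    n+e≤k : n + e ≤ k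
    n+e≤k = ≤-trans (+-monoʳ-≤ n e≤W) (+-cancelʳ-≤ W (n + W) k n+W+W≤k+W)
      where
      n+W+W≤k+W : n + W + W ≤ k + W
      n+W+W≤k+W = subst (_≤ k + W) (sym (+-assoc n W W)) (≤-trans budget (+-monoʳ-≤ k e≤W))

  final : ∀ {Y k} y → toℕ y ≡ Y → Walk n d r (zeros , origin) (allOnes , y) k → Final Y k
  final {Y} {k} y y≡Y w with trace-walk w trace-start
  ... | trace L W s L≤W s≤W position budget flippedAt = record
    { W       = W
    ; e       = ∣ s - L ∣
    ; window  = window-bound W L (λ p → flippedAt p (lookup-replicate p true))
    ; budget  = subst (λ z → z + (W + W) ≤ k + ∣ s - L ∣) (ones-replicate-true n) budget
    ; e≤W     = ≤-trans (∣m-n∣≤m⊔n s L) (⊔-lub s≤W L≤W)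
    ; residue = signed-difference r (subst (λ z → (z + L) % r ≡ s % r) y≡Y position)
    }

  -- Reaching (1⃗ , 0) from (0⃗ , 0) costs at least n + M, for any M ≤ r with M ≤ 2W for every
  -- window W whose positions cover Z_n: either the walk returns with no net displacement and
  -- pays 2W, or it winds around the ring and pays e ≥ r.
  lower-bound-antipode : ∀ M → M ≤ r → (∀ W → n ≤ d * suc W → M ≤ W + W) →
                         ∀ k → Walk n d r (zeros , origin) (allOnes , origin) k → n + M ≤ k
  lower-bound-antipode M M≤r M≤2W k w = from (final origin (toℕ-fromℕ< _) w)
    where
    from : Final 0 k → n + M ≤ k
    from F with multiple-0-or-≥ (Final.e F) r (zero-residue r (Final.residue F))
    ... | inj₁ e≡0 = begin
      n + M        ≤⟨ +-monoʳ-≤ n (M≤2W W window) ⟩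
      n + (W + W)  ≤⟨ budget ⟩
      k + e        ≡⟨ cong (k +_) e≡0 ⟩
      k + 0        ≡⟨ +-identityʳ k ⟩
      k            ∎
      where
      open Final F
      open ≤-Reasoning
    ... | inj₂ r≤e = ≤-trans (+-monoʳ-≤ n (≤-trans M≤r r≤e)) n+e≤k
      where open Final F

  -- Reaching (1⃗ , y) with toℕ y = t, 1 ≤ t and 2t ≤ r costs at least n + t, as e ≡ ±t forces e ≥ t.
  lower-bound-half : ∀ t y → toℕ y ≡ t → 1 ≤ t → t + t ≤ r →
                     ∀ k → Walk n d r (zeros , origin) (allOnes , y) k → n + t ≤ k
  lower-bound-half t y y≡t 1≤t 2t≤r k w =
    ≤-trans (+-monoʳ-≤ n (±t-residue-≥ 2t≤r (±t-residues r t e 1≤t 2t≤r residue))) n+e≤k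
    where open Final (final y y≡t w)

  lower-bound-half-tight : ∀ t y → toℕ y ≡ t → 1 ≤ t → t + t ≤ r →
                           (∀ W → n ≤ d * suc W → r ≤ suc W) →
                           ∀ k → Walk n d r (zeros , origin) (allOnes , y) k → n + (r + t) ≤ k + 2
  lower-bound-half-tight t y y≡t 1≤t 2t≤r r≤1+W k w =
    tight-bound 2t≤r (r≤1+W W window) budget n+e≤k (±t-residues r t e 1≤t 2t≤r residue)
    where open Final (final y y≡t w)

  half : Fin r
  half = fromℕ< (subst (λ z → ⌊ z /2⌋ < z) (suc-pred r) (⌊n/2⌋<n (pred r)))

  window-≥r : d * r ≡ n → ∀ W → n ≤ d * suc W → r ≤ suc W
  window-≥r dr≡n W cov = *-cancelˡ-≤ d (subst (_≤ d * suc W) (sym dr≡n) cov)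

  diameter-dr≡n-r≡3 : d * r ≡ n → r ≡ 3 → IsDiameter n d r (n + r)
  diameter-dr≡n-r≡3 dr≡n r≡3 =
    upper-bound-ring (≤-reflexive (sym dr≡n)) r ≤-refl detour≤r ,
    (zeros , origin) , (allOnes , origin) ,
    lower-bound-antipode r ≤-refl (λ W cov → ≤1+W⇒≤2W 2≤r (window-≥r dr≡n W cov))
    where
    detour≤r : r + ⌊ r /2⌋ ∸ 2 ≤ r
    detour≤r = subst (λ z → z + ⌊ z /2⌋ ∸ 2 ≤ z) (sym r≡3) (s≤s (s≤s z≤n))
    2≤r : 2 ≤ r
    2≤r = subst (2 ≤_) (sym r≡3) (s≤s (s≤s z≤n))

  diameter-dr≡n-r≥4 : d * r ≡ n → 4 ≤ r → IsDiameter n d r (n + ⌊ 3 * r /2⌋ ∸ 2)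
  diameter-dr≡n-r≥4 dr≡n 4≤r =
    subst (λ D → IsDiameter n d r (n + D ∸ 2)) (sym (⌊3m/2⌋≡m+⌊m/2⌋ r)) (upper , lower)
    where
    t = ⌊ r /2⌋
    2≤t : 2 ≤ t
    2≤t = ⌊n/2⌋-mono 4≤r
    1≤t : 1 ≤ t
    1≤t = ≤-trans (s≤s z≤n) 2≤t
    2≤r+t : 2 ≤ r + t
    2≤r+t = ≤-trans 2≤t (m≤n+m t r)
    r≤r+t∸2 : r ≤ r + t ∸ 2
    r≤r+t∸2 = m+n≤o⇒m≤o∸n r (+-monoʳ-≤ r 2≤t)
    upper : ∀ u v → Reach≤ u v (n + (r + t) ∸ 2)
    upper u v = subst (Reach≤ u v) (sym (+-∸-assoc n 2≤r+t))
                      (upper-bound-ring (≤-reflexive (sym dr≡n)) (r + t ∸ 2) r≤r+t∸2 ≤-refl u v)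
    lower : ∃[ u ] ∃[ v ] (∀ k → Walk n d r u v k → n + (r + t) ∸ 2 ≤ k)
    lower = (zeros , origin) , (allOnes , half) , λ k w →
      m≤n+o⇒m∸n≤o (n + (r + t)) 2 (subst (n + (r + t) ≤_) (+-comm k 2)
        (lower-bound-half-tight t half (toℕ-fromℕ< _) 1≤t (double-⌊/2⌋≤ r) (window-≥r dr≡n) k w))

  -- Case d r ≥ 2n: the diameter is n + max(⌊r/2⌋, 2⌈n/d⌉ − 2), attained at (1⃗ , 0) or
  -- (1⃗ , ⌊r/2⌋).  Here n ≤ d (t+1), so 2⌈n/d⌉ − 2 ≤ 2t ≤ r.
  diameter-dr≥2n : 3 ≤ r → 2 * n ≤ d * r →
                   IsDiameter n d r (n + (⌊ r /2⌋ ⊔ (2 * ceilDiv n d ∸ 2)))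
  diameter-dr≥2n 3≤r 2n≤dr = upper , lower
    where
    t = ⌊ r /2⌋
    M = 2 * ceilDiv n d ∸ 2
    1≤t : 1 ≤ t
    1≤t = ⌊n/2⌋-mono 3≤r
    n≤d[t+1] : n ≤ d * suc t
    n≤d[t+1] = *-cancelˡ-≤ 2 (begin
      2 * n                  ≤⟨ 2n≤dr ⟩
      d * r                  ≤⟨ *-monoʳ-≤ d (≤1+double-⌊/2⌋ r) ⟩
      d * suc (t + t)        ≤⟨ *-monoʳ-≤ d (n≤1+n _) ⟩
      d * suc (suc (t + t))  ≡⟨ twice d t ⟩
      2 * (d * suc t)        ∎)
      where
      open ≤-Reasoning
      twice : ∀ d t → d * suc (suc (t + t)) ≡ 2 * (d * suc t)
      twice = solve-∀
    M≤r : M ≤ r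
    M≤r = ≤-trans (2ceilDiv∸2≤ n d t n≤d[t+1]) (double-⌊/2⌋≤ r)
    upper : ∀ u v → Reach≤ u v (n + (t ⊔ M))
    upper with m≤n⇒∃[o]m+o≡n (ceilDiv-pos n d)
    ... | K , 1+K≡c = subst (λ z → ∀ u v → Reach≤ u v (n + (t ⊔ z))) M≡2K (upper-bound-window K cov)
      where
      cov : n ≤ d * suc K
      cov = subst (λ c → n ≤ d * c) (sym 1+K≡c) (ceilDiv-covers n d)
      M≡2K : K + K ≡ M
      M≡2K = trans (sym (double-pred K)) (cong (λ c → 2 * c ∸ 2) 1+K≡c)
    lower : ∃[ u ] ∃[ v ] (∀ k → Walk n d r u v k → n + (t ⊔ M) ≤ k)
    lower with t ≤? M
    ... | yes t≤M = (zeros , origin) , (allOnes , origin) , λ k w →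
          subst (λ D → n + D ≤ k) (sym (m≤n⇒m⊔n≡n t≤M))
                (lower-bound-antipode M M≤r (λ W → 2ceilDiv∸2≤ n d W) k w)
    ... | no t≰M  = (zeros , origin) , (allOnes , half) , λ k w →
          subst (λ D → n + D ≤ k) (sym (m≥n⇒m⊔n≡m (<⇒≤ (≰⇒> t≰M))))
                (lower-bound-half t half (toℕ-fromℕ< _) 1≤t (double-⌊/2⌋≤ r) k w)

theorem4p1 : (n d r : ℕ) .{{_ : NonZero n}} .{{_ : NonZero d}} .{{_ : NonZero r}} →
    2 ≤ n → 1 ≤ d → 3 ≤ r → d ≤ n → n ∣ d * r →
    ((d * r ≡ n →
        (r ≡ 3 → IsDiameter n d r (n + r)) ×
        (4 ≤ r → IsDiameter n d r (n + ⌊ 3 * r /2⌋ ∸ 2))) ×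
     (2 * n ≤ d * r →
        IsDiameter n d r (n + (⌊ r /2⌋ ⊔ (2 * ceilDiv n d ∸ 2)))))
theorem4p1 n d r _ _ 3≤r _ n∣dr =
  (λ dr≡n → diameter-dr≡n-r≡3 dr≡n , diameter-dr≡n-r≥4 dr≡n) , diameter-dr≥2n 3≤r
  where open Graph n d r n∣dr
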